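{- Let $k,\ell_1,\ell_2,\ell_1',\ell_2'\in\mathbb N^+$, $r\in\mathbb N$ and $M$ a finite subset of $\mathbb N^+$. If $\widehat{\mathfrak G}_{k\ell_1}\equiv_r^M\widehat{\mathfrak G}_{k\ell_1'}$ and $\widehat{\mathfrak G}_{k\ell_2}\equiv_r^M\widehat{\mathfrak G}_{k\ell_2'}$, then $\widehat{\mathfrak G}_{k,\ell_1+\ell_2}\equiv_r^M\widehat{\mathfrak G}_{k,\ell_1'+\ell_2'}$.
   Context: For $k,\ell\in\mathbb N^+$, the horizontally coloured cliquey $(k,\ell)$-grid $\widehat{\mathfrak G}_{k\ell}$ is the $\{\sim_v,P_1,\dots,P_k\}$-structure with universe $\{0,\dots,k-1\}\times\{0,\dots,\ell-1\}$, where $(x,y)\sim_v(x',y')$ iff $y=y'$, and $P_i=\{(i-1,y):0\le y<\ell\}$ for $1\le i\le k$. For $r\in\mathbb N$ and finite $M\subseteq\mathbb N^+$, $\mathfrak A\equiv_r^M\mathfrak B$ means that $\mathfrak A$ and $\mathfrak B$ satisfy the same sentences of $\mathrm{CMSO}^{(M)}$ of quantifier rank at most $r$, where $\mathrm{CMSO}^{(M)}$ is monadic second-order logic extended by atomic predicates $C^{(m,q)}(X)$ ($X$ a set variable, $m\in M$, $0\le q<m$) expressing $|X|\equiv q\pmod m$, and quantifier rank counts first-order and set quantifiers as in MSO. -}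

module Defs where

open import Data.Nat using (ℕ; zero; suc; _+_; _*_; _⊔_; _≤_)
open import Data.Fin using (Fin; toℕ)
open import Data.Bool using (Bool; true; false; if_then_else_)
open import Data.List using (List; map; allFin)
open import Data.Nat.ListAction using (sum)
open import Data.List.Membership.Propositional using (_∈_)
open import Data.Product using (Σ; _×_; proj₁; proj₂; ∃)
open import Data.Sum using (_⊎_)
open import Data.Vec.Functional using (Vector; _∷_)
open import Relation.Binary.PropositionalEquality using (_≡_)
open import Relation.Nullary using (¬_)
open import Function.Bundles using (_⇔_)

Elem : ℕ → ℕ → Set
Elem k ℓ = Fin k × Fin ℓ

Subset : ℕ → ℕ → Set
Subset k ℓ = Elem k ℓ → Bool

card : ∀ {k ℓ} → Subset k ℓ → ℕ
card {k} {ℓ} X =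
  sum (map (λ x → sum (map (λ y → if X (x , y) then 1 else 0) (allFin ℓ))) (allFin k))
  where open import Data.Product using (_,_)

-- CMSO^(M) formulas over the signature {∼_v, P_1, …, P_k},
-- with n first-order variables and s set variables in scope (de Bruijn indices).
-- The predicate P_(i+1) is written `P i` for i : Fin k.
data Form (k : ℕ) (M : List ℕ) : ℕ → ℕ → Set where
  eq   : ∀ {n s} → Fin n → Fin n → Form k M n s
  sim  : ∀ {n s} → Fin n → Fin n → Form k M n s
  P    : ∀ {n s} → Fin k → Fin n → Form k M n s
  mem  : ∀ {n s} → Fin n → Fin s → Form k M n s
  C    : ∀ {n s} (m : ℕ) → m ∈ M → Fin m → Fin s → Form k M n s
  neg  : ∀ {n s} → Form k M n s → Form k M n s
  and  : ∀ {n s} → Form k M n s → Form k M n s → Form k M n s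
  or   : ∀ {n s} → Form k M n s → Form k M n s → Form k M n s
  ex1  : ∀ {n s} → Form k M (suc n) s → Form k M n s
  all1 : ∀ {n s} → Form k M (suc n) s → Form k M n s
  ex2  : ∀ {n s} → Form k M n (suc s) → Form k M n s
  all2 : ∀ {n s} → Form k M n (suc s) → Form k M n s

Sentence : ℕ → List ℕ → Set
Sentence k M = Form k M 0 0

qr : ∀ {k M n s} → Form k M n s → ℕ
qr (eq _ _) = 0
qr (sim _ _) = 0
qr (P _ _) = 0
qr (mem _ _) = 0
qr (C _ _ _ _) = 0
qr (neg φ) = qr φ
qr (and φ ψ) = qr φ ⊔ qr ψ
qr (or φ ψ) = qr φ ⊔ qr ψ
qr (ex1 φ) = suc (qr φ)
qr (all1 φ) = suc (qr φ)
qr (ex2 φ) = suc (qr φ)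
qr (all2 φ) = suc (qr φ)

-- Satisfaction in the horizontally coloured cliquey grid 𝔊̂_{kℓ}:
-- (x,y) ∼_v (x',y') iff y = y';  P_(i+1) = {(i , y)}.
Sat : ∀ {k M n s} (ℓ : ℕ) → Form k M n s →
      Vector (Elem k ℓ) n → Vector (Subset k ℓ) s → Set
Sat ℓ (eq a b) ρ σ = ρ a ≡ ρ b
Sat ℓ (sim a b) ρ σ = proj₂ (ρ a) ≡ proj₂ (ρ b)
Sat ℓ (P i a) ρ σ = proj₁ (ρ a) ≡ i
Sat ℓ (mem a X) ρ σ = σ X (ρ a) ≡ true
Sat ℓ (C m _ q X) ρ σ = ∃ λ t → card (σ X) ≡ toℕ q + t * m
Sat ℓ (neg φ) ρ σ = ¬ Sat ℓ φ ρ σ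
Sat ℓ (and φ ψ) ρ σ = Sat ℓ φ ρ σ × Sat ℓ ψ ρ σ
Sat ℓ (or φ ψ) ρ σ = Sat ℓ φ ρ σ ⊎ Sat ℓ ψ ρ σ
Sat {k} ℓ (ex1 φ) ρ σ = Σ (Elem k ℓ) λ e → Sat ℓ φ (e ∷ ρ) σ
Sat {k} ℓ (all1 φ) ρ σ = (e : Elem k ℓ) → Sat ℓ φ (e ∷ ρ) σ
Sat {k} ℓ (ex2 φ) ρ σ = Σ (Subset k ℓ) λ X → Sat ℓ φ ρ (X ∷ σ)
Sat {k} ℓ (all2 φ) ρ σ = (X : Subset k ℓ) → Sat ℓ φ ρ (X ∷ σ)

_⊨_ : ∀ {k M} (ℓ : ℕ) → Sentence k M → Set
ℓ ⊨ φ = Sat ℓ φ (λ ()) (λ ())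

GridEquiv : (k : ℕ) (r : ℕ) (M : List ℕ) (ℓ ℓ' : ℕ) → Set
GridEquiv k r M ℓ ℓ' = (φ : Sentence k M) → qr φ ≤ r → (ℓ ⊨ φ) ⇔ (ℓ' ⊨ φ)

module Submission where

-- The proof goes through Ehrenfeucht–Fraïssé games for CMSO^(M).
--  * A position of the r-round game on two grids is a pair of assignments to
--    n element variables and s set variables; Duplicator wins it when the two
--    sides agree on all atomic formulas and, for r > 0, every element or set
--    move of Spoiler on either side can be answered by a winning position for
--    r - 1 rounds.  Winning positions satisfy the same formulas of rank ≤ r
--    (soundness, `sound`).
--  * Cutting the ℓ₁ + ℓ₂ rows of a grid into its first ℓ₁ and last ℓ₂ rows,
--    two winning strategies on the parts combine to one on the whole grid
--    (`compose`): element moves are answered on the part where they fall, set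
--    moves part by part.  Atomic formulas transfer because elements of
--    different parts are never equal or ∼_v-related, and C^(m,q) transfers
--    because cardinalities add up and congruence mod m respects addition.
--  * Conversely to soundness, the r-round Hintikka formula of a position (a
--    rank-r formula describing it up to the game) shows that ≡_r^M yields a
--    winning position for the empty assignments (completeness, `complete`).

open import Data.Bool using (Bool; true; false; if_then_else_)
import Data.Bool.Properties as Bool
open import Data.Empty using (⊥; ⊥-elim)
open import Data.Fin using (Fin; zero; suc; toℕ; fromℕ<; _↑ˡ_; _↑ʳ_; splitAt; combine; remQuot)
import Data.Fin.Properties as Fin
open import Data.List.Properties using (map-cong; map-tabulate)
open import Data.List using (List; []; _++_; map; concat; allFin; cartesianProduct; cartesianProductWith) renaming (_∷_ to _∷ₗ_)
open import Data.List.Membership.Propositional using (_∈_; mapWith∈)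
open import Data.List.Membership.Propositional.Properties
  using (∈-allFin; ∈-map⁺; ∈-++⁺ˡ; ∈-++⁺ʳ; ∈-concat⁺′; ∈-cartesianProduct⁺; ∈-cartesianProductWith⁺)
open import Data.List.Relation.Unary.All using (All)
open import Data.List.Relation.Unary.Any using (here; there)
open import Data.List.Relation.Unary.Any.Properties using (mapWith∈⁺)
open import Data.Nat using (ℕ; zero; suc; _+_; _*_; _≤_; z≤n; s≤s; NonZero)
open import Data.Nat.DivMod using (_%_; _/_; m≡m%n+[m/n]*n; [m+kn]%n≡m%n; m<n⇒m%n≡m; m%n<n; %-distribˡ-+)
open import Data.Nat.ListAction using (sum)
import Data.Nat as ℕ
open import Data.Nat.Properties using (⊔-lub; m⊔n≤o⇒m≤o; m⊔n≤o⇒n≤o; +-assoc; +-commutativeSemigroup)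
open import Algebra.Properties.CommutativeSemigroup +-commutativeSemigroup using () renaming (interchange to +-interchange)
open import Data.Product using (Σ; ∃; _×_; _,_; proj₁; proj₂)
open import Data.Product.Function.NonDependent.Propositional using (_×-⇔_)
open import Data.Product.Properties using (≡-dec)
open import Data.Sum using (_⊎_; inj₁; inj₂; [_,_]′)
open import Data.Sum.Function.Propositional using (_⊎-⇔_)
open import Data.Unit using (⊤; tt)
open import Data.Vec.Functional using (_∷_)
open import Function using (_∘_; flip)
open import Function.Bundles using (_⇔_; mk⇔; Equivalence)
open import Function.Properties.Equivalence using () renaming (refl to ⇔-refl; sym to ⇔-sym; trans to ⇔-trans)
open import Function.Related.TypeIsomorphisms using (¬-cong-⇔)
open import Relation.Binary.PropositionalEquality
  using (_≡_; refl; sym; trans; cong; cong₂; subst; subst₂; _≗_; module ≡-Reasoning)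
open import Relation.Nullary using (¬_; Dec; yes; no)
import Relation.Nullary.Decidable as Dec

open import Defs

open Equivalence using (to; from)

subst⇔ : ∀ {A : Set} (F : A → Set) {x y : A} → x ≡ y → F x ⇔ F y
subst⇔ F x≡y = mk⇔ (subst F x≡y) (subst F (sym x≡y))

≡-resp⇔ : ∀ {A : Set} {x x' y y' : A} → x ≡ x' → y ≡ y' → (x ≡ y) ⇔ (x' ≡ y')
≡-resp⇔ x≡x' y≡y' = mk⇔ (subst₂ _≡_ x≡x' y≡y') (subst₂ _≡_ (sym x≡x') (sym y≡y'))

through : ∀ {A B C D : Set} → A ⇔ C → C ⇔ D → B ⇔ D → A ⇔ B
through A⇔C C⇔D B⇔D = ⇔-trans A⇔C (⇔-trans C⇔D (⇔-sym B⇔D))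

absurd⇔ : ∀ {A B : Set} → ¬ A → ¬ B → A ⇔ B
absurd⇔ ¬a ¬b = mk⇔ (⊥-elim ∘ ¬a) (⊥-elim ∘ ¬b)

∃-cong⇔ : ∀ {A : Set} {B C : A → Set} → (∀ a → B a ⇔ C a) → Σ A B ⇔ Σ A C
∃-cong⇔ B⇔C = mk⇔ (λ (a , b) → a , to (B⇔C a) b) (λ (a , c) → a , from (B⇔C a) c)

∀-cong⇔ : ∀ {A : Set} {B C : A → Set} → (∀ a → B a ⇔ C a) → ((a : A) → B a) ⇔ ((a : A) → C a)
∀-cong⇔ B⇔C = mk⇔ (λ b a → to (B⇔C a) (b a)) (λ c a → from (B⇔C a) (c a))

module Transfer {A B : Set} {R : A → B → Set}
    (forth : ∀ a → Σ B (R a)) (back : ∀ b → Σ A (flip R b))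
    {S : A → Set} {T : B → Set} (S⇔T : ∀ {a b} → R a b → S a ⇔ T b) where

  ∃-transfer : Σ A S ⇔ Σ B T
  ∃-transfer = mk⇔
    (λ (a , sa) → let (b , r) = forth a in b , to (S⇔T r) sa)
    (λ (b , tb) → let (a , r) = back b in a , from (S⇔T r) tb)

  ∀-transfer : ((a : A) → S a) ⇔ ((b : B) → T b)
  ∀-transfer = mk⇔
    (λ sa b → let (a , r) = back b in to (S⇔T r) (sa a))
    (λ tb a → let (b , r) = forth a in from (S⇔T r) (tb b))

∑ : (N : ℕ) → (Fin N → ℕ) → ℕ
∑ N f = sum (map f (allFin N))

∑-cong : ∀ N {f g : Fin N → ℕ} → f ≗ g → ∑ N f ≡ ∑ N g
∑-cong N f≗g = cong sum (map-cong f≗g (allFin N))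

∑-suc : ∀ N (f : Fin (suc N) → ℕ) → ∑ (suc N) f ≡ f zero + ∑ N (f ∘ suc)
∑-suc N f = cong (λ xs → f zero + sum xs)
  (trans (map-tabulate suc f) (sym (map-tabulate (λ i → i) (f ∘ suc))))

∑-++ : ∀ a b (f : Fin (a + b) → ℕ) → ∑ (a + b) f ≡ ∑ a (f ∘ (_↑ˡ b)) + ∑ b (f ∘ (a ↑ʳ_))
∑-++ zero    b f = refl
∑-++ (suc a) b f = begin
  ∑ (suc a + b) f                                                     ≡⟨ ∑-suc (a + b) f ⟩
  f zero + ∑ (a + b) (f ∘ suc)                                        ≡⟨ cong (f zero +_) (∑-++ a b (f ∘ suc)) ⟩
  f zero + (∑ a (f ∘ suc ∘ (_↑ˡ b)) + ∑ b (f ∘ suc ∘ (a ↑ʳ_)))         ≡⟨ +-assoc (f zero) _ _ ⟨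
  (f zero + ∑ a (f ∘ suc ∘ (_↑ˡ b))) + ∑ b (f ∘ (suc a ↑ʳ_))           ≡⟨ cong (_+ ∑ b (f ∘ (suc a ↑ʳ_))) (∑-suc a (f ∘ (_↑ˡ b))) ⟨
  ∑ (suc a) (f ∘ (_↑ˡ b)) + ∑ b (f ∘ (suc a ↑ʳ_))                      ∎
  where open ≡-Reasoning

∑-+ : ∀ N (f g : Fin N → ℕ) → ∑ N (λ i → f i + g i) ≡ ∑ N f + ∑ N g
∑-+ zero    f g = refl
∑-+ (suc N) f g = begin
  ∑ (suc N) (λ i → f i + g i)                                ≡⟨ ∑-suc N _ ⟩
  (f zero + g zero) + ∑ N (λ i → f (suc i) + g (suc i))      ≡⟨ cong ((f zero + g zero) +_) (∑-+ N (f ∘ suc) (g ∘ suc)) ⟩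
  (f zero + g zero) + (∑ N (f ∘ suc) + ∑ N (g ∘ suc))        ≡⟨ +-interchange (f zero) (g zero) _ _ ⟩
  (f zero + ∑ N (f ∘ suc)) + (g zero + ∑ N (g ∘ suc))        ≡⟨ cong₂ _+_ (∑-suc N f) (∑-suc N g) ⟨
  ∑ (suc N) f + ∑ (suc N) g                                  ∎
  where open ≡-Reasoning

Residue : (m : ℕ) → Fin m → ℕ → Set
Residue m q c = ∃ λ t → c ≡ toℕ q + t * m

residue⇔% : ∀ {m} (q : Fin (suc m)) c → Residue (suc m) q c ⇔ (c % suc m ≡ toℕ q)
residue⇔% {m} q c = mk⇔
  (λ (t , c≡q+tm) → trans (cong (_% suc m) c≡q+tm)
                          (trans ([m+kn]%n≡m%n (toℕ q) t (suc m)) (m<n⇒m%n≡m (Fin.toℕ<n q))))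
  (λ c%m≡q → c / suc m , trans (m≡m%n+[m/n]*n c (suc m)) (cong (_+ (c / suc m) * suc m) c%m≡q))

residue? : ∀ m (q : Fin m) c → Dec (Residue m q c)
residue? (suc m) q c = Dec.map (⇔-sym (residue⇔% q c)) (c % suc m ℕ.≟ toℕ q)

SameResidues : ℕ → ℕ → ℕ → Set
SameResidues m c c' = (q : Fin m) → Residue m q c ⇔ Residue m q c'

sameResidues⇒% : ∀ {m c c'} → SameResidues (suc m) c c' → c % suc m ≡ c' % suc m
sameResidues⇒% {m} {c} {c'} same = trans (sym q≡c%m) (sym (to (residue⇔% q c') (to (same q) c≡q)))
  where
  q : Fin (suc m)
  q = fromℕ< (m%n<n c (suc m))
  q≡c%m : toℕ q ≡ c % suc m
  q≡c%m = Fin.toℕ-fromℕ< (m%n<n c (suc m))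
  c≡q : Residue (suc m) q c
  c≡q = from (residue⇔% q c) (sym q≡c%m)

%⇒sameResidues : ∀ {m c c'} → c % suc m ≡ c' % suc m → SameResidues (suc m) c c'
%⇒sameResidues {c = c} {c'} c≡c' q =
  ⇔-trans (residue⇔% q c) (⇔-trans (≡-resp⇔ c≡c' refl) (⇔-sym (residue⇔% q c')))

sameResidues-+ : ∀ {m c₁ c₁' c₂ c₂'} → SameResidues m c₁ c₁' → SameResidues m c₂ c₂' →
                 SameResidues m (c₁ + c₂) (c₁' + c₂')
sameResidues-+ {zero}                       _  _  ()
sameResidues-+ {suc m} {c₁} {c₁'} {c₂} {c₂'} s₁ s₂ = %⇒sameResidues (begin
  (c₁ + c₂) % suc m                     ≡⟨ %-distribˡ-+ c₁ c₂ (suc m) ⟩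
  (c₁ % suc m + c₂ % suc m) % suc m     ≡⟨ cong₂ (λ u v → (u + v) % suc m) (sameResidues⇒% s₁) (sameResidues⇒% s₂) ⟩
  (c₁' % suc m + c₂' % suc m) % suc m   ≡⟨ %-distribˡ-+ c₁' c₂' (suc m) ⟨
  (c₁' + c₂') % suc m                   ∎)
  where open ≡-Reasoning

module Grids (k : ℕ) (M : List ℕ) where

  Points : ℕ → ℕ → Set
  Points ℓ n = Fin n → Elem k ℓ

  Sets : ℕ → ℕ → Set
  Sets ℓ s = Fin s → Subset k ℓ

  -- Pointwise equality of set assignments (subsets are functions, so this is
  -- the relevant notion of equality).
  _≐_ : ∀ {ℓ s} → Sets ℓ s → Sets ℓ s → Set
  σ₁ ≐ σ₂ = ∀ X → σ₁ X ≗ σ₂ X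

  ≐-∷ : ∀ {ℓ s} {σ₁ σ₂ : Sets ℓ s} (X : Subset k ℓ) → σ₁ ≐ σ₂ → (X ∷ σ₁) ≐ (X ∷ σ₂)
  ≐-∷ X σ₁≐σ₂ zero    = λ _ → refl
  ≐-∷ X σ₁≐σ₂ (suc Y) = σ₁≐σ₂ Y

  ≐-head : ∀ {ℓ s} {σ : Sets ℓ s} {X Y : Subset k ℓ} → X ≗ Y → (X ∷ σ) ≐ (Y ∷ σ)
  ≐-head X≗Y zero    = X≗Y
  ≐-head X≗Y (suc Z) = λ _ → refl

  ≗-∷ : ∀ {ℓ n} {ρ₁ ρ₂ : Points ℓ n} (e : Elem k ℓ) → ρ₁ ≗ ρ₂ → (e ∷ ρ₁) ≗ (e ∷ ρ₂)
  ≗-∷ e ρ₁≗ρ₂ zero    = refl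
  ≗-∷ e ρ₁≗ρ₂ (suc a) = ρ₁≗ρ₂ a

  bit : Bool → ℕ
  bit b = if b then 1 else 0

  card-cong : ∀ {ℓ} {X Y : Subset k ℓ} → X ≗ Y → card X ≡ card Y
  card-cong {ℓ} X≗Y = ∑-cong k λ x → ∑-cong ℓ λ y → cong bit (X≗Y (x , y))

  inl : ∀ {a} b → Elem k a → Elem k (a + b)
  inl b (x , y) = x , y ↑ˡ b

  inr : ∀ a {b} → Elem k b → Elem k (a + b)
  inr a (x , y) = x , a ↑ʳ y

  card-++ : ∀ a b (Z : Subset k (a + b)) → card Z ≡ card (Z ∘ inl b) + card (Z ∘ inr a)
  card-++ a b Z = trans
    (∑-cong k λ x → ∑-++ a b (λ y → bit (Z (x , y))))
    (∑-+ k (λ x → ∑ a (λ y → bit (Z (x , y ↑ˡ b)))) (λ x → ∑ b (λ y → bit (Z (x , a ↑ʳ y)))))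

  Sat-resp : ∀ {ℓ n s} (φ : Form k M n s) {ρ₁ ρ₂ : Points ℓ n} {σ₁ σ₂ : Sets ℓ s} →
             ρ₁ ≗ ρ₂ → σ₁ ≐ σ₂ → Sat ℓ φ ρ₁ σ₁ ⇔ Sat ℓ φ ρ₂ σ₂
  Sat-resp (eq a b)    ρ≗ σ≐ = ≡-resp⇔ (ρ≗ a) (ρ≗ b)
  Sat-resp (sim a b)   ρ≗ σ≐ = ≡-resp⇔ (cong proj₂ (ρ≗ a)) (cong proj₂ (ρ≗ b))
  Sat-resp (P i a)     ρ≗ σ≐ = ≡-resp⇔ (cong proj₁ (ρ≗ a)) refl
  Sat-resp (mem a X) {σ₂ = σ₂} ρ≗ σ≐ = ≡-resp⇔ (trans (σ≐ X _) (cong (σ₂ X) (ρ≗ a))) refl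
  Sat-resp (C m _ q X) ρ≗ σ≐ = subst⇔ (Residue m q) (card-cong (σ≐ X))
  Sat-resp (neg φ)     ρ≗ σ≐ = ¬-cong-⇔ (Sat-resp φ ρ≗ σ≐)
  Sat-resp (and φ ψ)   ρ≗ σ≐ = Sat-resp φ ρ≗ σ≐ ×-⇔ Sat-resp ψ ρ≗ σ≐
  Sat-resp (or φ ψ)    ρ≗ σ≐ = Sat-resp φ ρ≗ σ≐ ⊎-⇔ Sat-resp ψ ρ≗ σ≐
  Sat-resp (ex1 φ)     ρ≗ σ≐ = ∃-cong⇔ λ e → Sat-resp φ (≗-∷ e ρ≗) σ≐
  Sat-resp (all1 φ)    ρ≗ σ≐ = ∀-cong⇔ λ e → Sat-resp φ (≗-∷ e ρ≗) σ≐
  Sat-resp (ex2 φ)     ρ≗ σ≐ = ∃-cong⇔ λ X → Sat-resp φ ρ≗ (≐-∷ X σ≐)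
  Sat-resp (all2 φ)    ρ≗ σ≐ = ∀-cong⇔ λ X → Sat-resp φ ρ≗ (≐-∷ X σ≐)

  data Atom (n s : ℕ) : Set where
    eqᵃ simᵃ : Fin n → Fin n → Atom n s
    Pᵃ       : Fin k → Fin n → Atom n s
    memᵃ     : Fin n → Fin s → Atom n s
    Cᵃ       : ∀ {m} → m ∈ M → Fin m → Fin s → Atom n s

  ⌜_⌝ : ∀ {n s} → Atom n s → Form k M n s
  ⌜ eqᵃ a b    ⌝ = eq a b
  ⌜ simᵃ a b   ⌝ = sim a b
  ⌜ Pᵃ i a     ⌝ = P i a
  ⌜ memᵃ a X   ⌝ = mem a X
  ⌜ Cᵃ m∈M q X ⌝ = C _ m∈M q X

  atom? : ∀ {ℓ n s} (α : Atom n s) (ρ : Points ℓ n) (σ : Sets ℓ s) → Dec (Sat ℓ ⌜ α ⌝ ρ σ)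
  atom? (eqᵃ a b)          ρ σ = ≡-dec Fin._≟_ Fin._≟_ (ρ a) (ρ b)
  atom? (simᵃ a b)         ρ σ = proj₂ (ρ a) Fin.≟ proj₂ (ρ b)
  atom? (Pᵃ i a)           ρ σ = proj₁ (ρ a) Fin.≟ i
  atom? (memᵃ a X)         ρ σ = σ X (ρ a) Bool.≟ true
  atom? (Cᵃ {m} _ q X)     ρ σ = residue? m q (card (σ X))

  PosRel : ℕ → ℕ → Set₁
  PosRel ℓ ℓ' = ∀ {n s} → Points ℓ n → Points ℓ' n → Sets ℓ s → Sets ℓ' s → Set

  Agree : ∀ {ℓ ℓ'} → PosRel ℓ ℓ'
  Agree {ℓ} {ℓ'} ρ ρ' σ σ' = ∀ α → Sat ℓ ⌜ α ⌝ ρ σ ⇔ Sat ℓ' ⌜ α ⌝ ρ' σ'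

  record Moves {ℓ ℓ'} (G : PosRel ℓ ℓ') {n s}
               (ρ : Points ℓ n) (ρ' : Points ℓ' n) (σ : Sets ℓ s) (σ' : Sets ℓ' s) : Set where
    field
      elemˡ : ∀ e  → Σ (Elem k ℓ') λ e' → G (e ∷ ρ) (e' ∷ ρ') σ σ'
      elemʳ : ∀ e' → Σ (Elem k ℓ) λ e → G (e ∷ ρ) (e' ∷ ρ') σ σ'
      setˡ  : ∀ X  → Σ (Subset k ℓ') λ X' → G ρ ρ' (X ∷ σ) (X' ∷ σ')
      setʳ  : ∀ X' → Σ (Subset k ℓ) λ X → G ρ ρ' (X ∷ σ) (X' ∷ σ')
  open Moves

  Moves-map : ∀ {ℓ ℓ'} {G H : PosRel ℓ ℓ'} → (∀ {n s ρ ρ' σ σ'} → G {n} {s} ρ ρ' σ σ' → H ρ ρ' σ σ') →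
              ∀ {n s ρ ρ' σ σ'} → Moves G {n} {s} ρ ρ' σ σ' → Moves H ρ ρ' σ σ'
  Moves-map G⇒H mv = record
    { elemˡ = λ e  → let (e' , g) = elemˡ mv e  in e' , G⇒H g
    ; elemʳ = λ e' → let (e , g)  = elemʳ mv e' in e  , G⇒H g
    ; setˡ  = λ X  → let (X' , g) = setˡ mv X   in X' , G⇒H g
    ; setʳ  = λ X' → let (X , g)  = setʳ mv X'  in X  , G⇒H g
    }

  Game : ∀ {ℓ ℓ'} → ℕ → PosRel ℓ ℓ'
  Game zero    ρ ρ' σ σ' = Agree ρ ρ' σ σ'
  Game (suc r) ρ ρ' σ σ' = Agree ρ ρ' σ σ' × Moves (Game r) ρ ρ' σ σ'

  agree : ∀ {ℓ ℓ' n s} r {ρ : Points ℓ n} {ρ' : Points ℓ' n} {σ : Sets ℓ s} {σ' : Sets ℓ' s} →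
          Game r ρ ρ' σ σ' → Agree ρ ρ' σ σ'
  agree zero    g        = g
  agree (suc r) (ag , _) = ag

  down : ∀ {ℓ ℓ' n s} r {ρ : Points ℓ n} {ρ' : Points ℓ' n} {σ : Sets ℓ s} {σ' : Sets ℓ' s} →
         Game (suc r) ρ ρ' σ σ' → Game r ρ ρ' σ σ'
  down zero    (ag , _)  = ag
  down (suc r) (ag , mv) = ag , Moves-map (down r) mv

  sound : ∀ {ℓ ℓ' n s} r {ρ : Points ℓ n} {ρ' : Points ℓ' n} {σ : Sets ℓ s} {σ' : Sets ℓ' s} →
          Game r ρ ρ' σ σ' → (φ : Form k M n s) → qr φ ≤ r → Sat ℓ φ ρ σ ⇔ Sat ℓ' φ ρ' σ'
  sound r g (eq a b)        _ = agree r g (eqᵃ a b)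
  sound r g (sim a b)       _ = agree r g (simᵃ a b)
  sound r g (P i a)         _ = agree r g (Pᵃ i a)
  sound r g (mem a X)       _ = agree r g (memᵃ a X)
  sound r g (C _ m∈M q X)   _ = agree r g (Cᵃ m∈M q X)
  sound r g (neg φ)   le = ¬-cong-⇔ (sound r g φ le)
  sound r g (and φ ψ) le = sound r g φ (m⊔n≤o⇒m≤o _ _ le) ×-⇔ sound r g ψ (m⊔n≤o⇒n≤o _ _ le)
  sound r g (or φ ψ)  le = sound r g φ (m⊔n≤o⇒m≤o _ _ le) ⊎-⇔ sound r g ψ (m⊔n≤o⇒n≤o _ _ le)
  sound (suc r) (_ , mv) (ex1 φ)  (s≤s le) = Transfer.∃-transfer (elemˡ mv) (elemʳ mv) λ g → sound r g φ le
  sound (suc r) (_ , mv) (all1 φ) (s≤s le) = Transfer.∀-transfer (elemˡ mv) (elemʳ mv) λ g → sound r g φ le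
  sound (suc r) (_ , mv) (ex2 φ)  (s≤s le) = Transfer.∃-transfer (setˡ mv) (setʳ mv) λ g → sound r g φ le
  sound (suc r) (_ , mv) (all2 φ) (s≤s le) = Transfer.∀-transfer (setˡ mv) (setʳ mv) λ g → sound r g φ le

  ↑ˡ-≡ : ∀ {a} b {i j : Fin a} → (i ↑ˡ b ≡ j ↑ˡ b) ⇔ (i ≡ j)
  ↑ˡ-≡ b = mk⇔ (Fin.↑ˡ-injective b _ _) (cong (_↑ˡ b))

  ↑ʳ-≡ : ∀ a {b} {i j : Fin b} → (a ↑ʳ i ≡ a ↑ʳ j) ⇔ (i ≡ j)
  ↑ʳ-≡ a = mk⇔ (Fin.↑ʳ-injective a _ _) (cong (a ↑ʳ_))

  ↑ˡ≢↑ʳ : ∀ a b {i : Fin a} {j : Fin b} → ¬ (i ↑ˡ b ≡ a ↑ʳ j)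
  ↑ˡ≢↑ʳ a b {i} {j} i≡j with trans (sym (Fin.splitAt-↑ˡ a i b)) (trans (cong (splitAt a) i≡j) (Fin.splitAt-↑ʳ a b j))
  ... | ()

  inl-≡ : ∀ {a} b {u v : Elem k a} → (inl b u ≡ inl b v) ⇔ (u ≡ v)
  inl-≡ b = mk⇔ (λ u≡v → cong₂ _,_ (cong proj₁ u≡v) (to (↑ˡ-≡ b) (cong proj₂ u≡v))) (cong (inl b))

  inr-≡ : ∀ a {b} {u v : Elem k b} → (inr a u ≡ inr a v) ⇔ (u ≡ v)
  inr-≡ a = mk⇔ (λ u≡v → cong₂ _,_ (cong proj₁ u≡v) (to (↑ʳ-≡ a) (cong proj₂ u≡v))) (cong (inr a))

  data Part (a b : ℕ) : Elem k (a + b) → Set where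
    first  : (u : Elem k a) → Part a b (inl b u)
    second : (v : Elem k b) → Part a b (inr a v)

  part : ∀ a b (e : Elem k (a + b)) → Part a b e
  part a b (x , y) with splitAt a y in split≡
  ... | inj₁ i = subst (Part a b) (cong (x ,_) (Fin.splitAt⁻¹-↑ˡ split≡)) (first (x , i))
  ... | inj₂ j = subst (Part a b) (cong (x ,_) (Fin.splitAt⁻¹-↑ʳ split≡)) (second (x , j))

  Restricts : ∀ {a b s} → Sets (a + b) s → Sets a s → Sets b s → Set
  Restricts {a} {b} σ σ₁ σ₂ = (∀ X → σ X ∘ inl b ≗ σ₁ X) × (∀ X → σ X ∘ inr a ≗ σ₂ X)

  Restricts-∷ : ∀ {a b s} {σ : Sets (a + b) s} {σ₁ : Sets a s} {σ₂ : Sets b s} (X : Subset k (a + b)) →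
                Restricts σ σ₁ σ₂ → Restricts (X ∷ σ) (X ∘ inl b ∷ σ₁) (X ∘ inr a ∷ σ₂)
  Restricts-∷ X (left , right) =
    (λ { zero → λ _ → refl ; (suc Y) → left Y }) , (λ { zero → λ _ → refl ; (suc Y) → right Y })

  glue : ∀ {a b} → Subset k a → Subset k b → Subset k (a + b)
  glue {a} A B (x , y) = [ (λ i → A (x , i)) , (λ j → B (x , j)) ]′ (splitAt a y)

  glue-inl : ∀ {a b} (A : Subset k a) (B : Subset k b) → glue A B ∘ inl b ≗ A
  glue-inl {a} {b} A B (x , i) = cong [ (λ i → A (x , i)) , (λ j → B (x , j)) ]′ (Fin.splitAt-↑ˡ a i b)

  glue-inr : ∀ {a b} (A : Subset k a) (B : Subset k b) → glue A B ∘ inr a ≗ B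
  glue-inr {a} {b} A B (x , j) = cong [ (λ i → A (x , i)) , (λ j → B (x , j)) ]′ (Fin.splitAt-↑ʳ a b j)

  Restricts-glue : ∀ {a b s} {σ : Sets (a + b) s} {σ₁ : Sets a s} {σ₂ : Sets b s} (A : Subset k a) (B : Subset k b) →
                   Restricts σ σ₁ σ₂ → Restricts (glue A B ∷ σ) (A ∷ σ₁) (B ∷ σ₂)
  Restricts-glue A B (left , right) =
    (λ { zero → glue-inl A B ; (suc Y) → left Y }) , (λ { zero → glue-inr A B ; (suc Y) → right Y })

  card-Restricts : ∀ {a b s} {σ : Sets (a + b) s} {σ₁ : Sets a s} {σ₂ : Sets b s} → Restricts σ σ₁ σ₂ →
                   ∀ X → card (σ X) ≡ card (σ₁ X) + card (σ₂ X)
  card-Restricts {a} {b} {σ = σ} (left , right) X =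
    trans (card-++ a b (σ X)) (cong₂ _+_ (card-cong (left X)) (card-cong (right X)))

  module Composition (ℓ₁ ℓ₂ ℓ₁' ℓ₂' : ℕ) where

    Split : ∀ {n n₁ n₂} → Points (ℓ₁ + ℓ₂) n → Points (ℓ₁' + ℓ₂') n →
            Points ℓ₁ n₁ → Points ℓ₁' n₁ → Points ℓ₂ n₂ → Points ℓ₂' n₂ → Set
    Split {n} {n₁} {n₂} ρ ρ' ρ₁ ρ₁' ρ₂ ρ₂' = ∀ a →
      (Σ (Fin n₁) λ b → ρ a ≡ inl ℓ₂ (ρ₁ b) × ρ' a ≡ inl ℓ₂' (ρ₁' b)) ⊎
      (Σ (Fin n₂) λ b → ρ a ≡ inr ℓ₁ (ρ₂ b) × ρ' a ≡ inr ℓ₁' (ρ₂' b))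

    Split-first : ∀ {n n₁ n₂} {ρ ρ'} {ρ₁ : Points ℓ₁ n₁} {ρ₁'} {ρ₂ : Points ℓ₂ n₂} {ρ₂'} u u' →
      Split {n} ρ ρ' ρ₁ ρ₁' ρ₂ ρ₂' → Split (inl ℓ₂ u ∷ ρ) (inl ℓ₂' u' ∷ ρ') (u ∷ ρ₁) (u' ∷ ρ₁') ρ₂ ρ₂'
    Split-first u u' split zero = inj₁ (zero , refl , refl)
    Split-first u u' split (suc a) with split a
    ... | inj₁ (b , eqs) = inj₁ (suc b , eqs)
    ... | inj₂ (b , eqs) = inj₂ (b , eqs)

    Split-second : ∀ {n n₁ n₂} {ρ ρ'} {ρ₁ : Points ℓ₁ n₁} {ρ₁'} {ρ₂ : Points ℓ₂ n₂} {ρ₂'} v v' →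
      Split {n} ρ ρ' ρ₁ ρ₁' ρ₂ ρ₂' → Split (inr ℓ₁ v ∷ ρ) (inr ℓ₁' v' ∷ ρ') ρ₁ ρ₁' (v ∷ ρ₂) (v' ∷ ρ₂')
    Split-second v v' split zero = inj₂ (zero , refl , refl)
    Split-second v v' split (suc a) with split a
    ... | inj₁ (b , eqs) = inj₁ (b , eqs)
    ... | inj₂ (b , eqs) = inj₂ (suc b , eqs)

    -- Agreement on atomic formulas is inherited from the parts: the
    -- relations = and ∼_v never hold between elements of different parts,
    -- and cardinalities (hence residues) add up.
    compose-agree : ∀ {n n₁ n₂ s} {ρ ρ'} {ρ₁ : Points ℓ₁ n₁} {ρ₁'} {ρ₂ : Points ℓ₂ n₂} {ρ₂'}
      {σ : Sets (ℓ₁ + ℓ₂) s} {σ' : Sets (ℓ₁' + ℓ₂') s} {σ₁ σ₁' σ₂ σ₂'} →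
      Agree ρ₁ ρ₁' σ₁ σ₁' → Agree ρ₂ ρ₂' σ₂ σ₂' → Split {n} ρ ρ' ρ₁ ρ₁' ρ₂ ρ₂' →
      Restricts σ σ₁ σ₂ → Restricts σ' σ₁' σ₂' → Agree ρ ρ' σ σ'
    compose-agree ag₁ ag₂ split res res' (eqᵃ a b) with split a | split b
    ... | inj₁ (a₁ , p , p') | inj₁ (b₁ , q , q') rewrite p | p' | q | q' =
      through (inl-≡ ℓ₂) (ag₁ (eqᵃ a₁ b₁)) (inl-≡ ℓ₂')
    ... | inj₂ (a₂ , p , p') | inj₂ (b₂ , q , q') rewrite p | p' | q | q' =
      through (inr-≡ ℓ₁) (ag₂ (eqᵃ a₂ b₂)) (inr-≡ ℓ₁')
    ... | inj₁ (a₁ , p , p') | inj₂ (b₂ , q , q') rewrite p | p' | q | q' =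
      absurd⇔ (↑ˡ≢↑ʳ ℓ₁ ℓ₂ ∘ cong proj₂) (↑ˡ≢↑ʳ ℓ₁' ℓ₂' ∘ cong proj₂)
    ... | inj₂ (a₂ , p , p') | inj₁ (b₁ , q , q') rewrite p | p' | q | q' =
      absurd⇔ (↑ˡ≢↑ʳ ℓ₁ ℓ₂ ∘ sym ∘ cong proj₂) (↑ˡ≢↑ʳ ℓ₁' ℓ₂' ∘ sym ∘ cong proj₂)
    compose-agree ag₁ ag₂ split res res' (simᵃ a b) with split a | split b
    ... | inj₁ (a₁ , p , p') | inj₁ (b₁ , q , q') rewrite p | p' | q | q' =
      through (↑ˡ-≡ ℓ₂) (ag₁ (simᵃ a₁ b₁)) (↑ˡ-≡ ℓ₂')
    ... | inj₂ (a₂ , p , p') | inj₂ (b₂ , q , q') rewrite p | p' | q | q' =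
      through (↑ʳ-≡ ℓ₁) (ag₂ (simᵃ a₂ b₂)) (↑ʳ-≡ ℓ₁')
    ... | inj₁ (a₁ , p , p') | inj₂ (b₂ , q , q') rewrite p | p' | q | q' =
      absurd⇔ (↑ˡ≢↑ʳ ℓ₁ ℓ₂) (↑ˡ≢↑ʳ ℓ₁' ℓ₂')
    ... | inj₂ (a₂ , p , p') | inj₁ (b₁ , q , q') rewrite p | p' | q | q' =
      absurd⇔ (↑ˡ≢↑ʳ ℓ₁ ℓ₂ ∘ sym) (↑ˡ≢↑ʳ ℓ₁' ℓ₂' ∘ sym)
    compose-agree ag₁ ag₂ split res res' (Pᵃ i a) with split a
    ... | inj₁ (a₁ , p , p') rewrite p | p' = ag₁ (Pᵃ i a₁)
    ... | inj₂ (a₂ , p , p') rewrite p | p' = ag₂ (Pᵃ i a₂)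
    compose-agree ag₁ ag₂ split (left , right) (left' , right') (memᵃ a X) with split a
    ... | inj₁ (a₁ , p , p') rewrite p | p' =
      through (≡-resp⇔ (left X _) refl) (ag₁ (memᵃ a₁ X)) (≡-resp⇔ (left' X _) refl)
    ... | inj₂ (a₂ , p , p') rewrite p | p' =
      through (≡-resp⇔ (right X _) refl) (ag₂ (memᵃ a₂ X)) (≡-resp⇔ (right' X _) refl)
    compose-agree ag₁ ag₂ split res res' (Cᵃ {m} m∈M q X) =
      through (subst⇔ (Residue m q) (card-Restricts res X))
              (sameResidues-+ (λ q → ag₁ (Cᵃ m∈M q X)) (λ q → ag₂ (Cᵃ m∈M q X)) q)
              (subst⇔ (Residue m q) (card-Restricts res' X))

    -- Winning strategies on the parts combine to one on the glued grids:
    -- element moves are answered in the part where they are played, set moves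
    -- part by part.
    compose : ∀ r {n n₁ n₂ s} {ρ ρ'} {ρ₁ : Points ℓ₁ n₁} {ρ₁'} {ρ₂ : Points ℓ₂ n₂} {ρ₂'}
      {σ : Sets (ℓ₁ + ℓ₂) s} {σ' : Sets (ℓ₁' + ℓ₂') s} {σ₁ σ₁' σ₂ σ₂'} →
      Game r ρ₁ ρ₁' σ₁ σ₁' → Game r ρ₂ ρ₂' σ₂ σ₂' → Split {n} ρ ρ' ρ₁ ρ₁' ρ₂ ρ₂' →
      Restricts σ σ₁ σ₂ → Restricts σ' σ₁' σ₂' → Game r ρ ρ' σ σ'
    compose zero g₁ g₂ split res res' = compose-agree g₁ g₂ split res res'
    compose (suc r) {ρ = ρ} {ρ'} {σ = σ} {σ'} g₁@(ag₁ , mv₁) g₂@(ag₂ , mv₂) split res res' =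
      compose-agree ag₁ ag₂ split res res' ,
      record { elemˡ = answer-elemˡ ; elemʳ = answer-elemʳ ; setˡ = answer-setˡ ; setʳ = answer-setʳ }
      where
      answer-elemˡ : ∀ e → Σ (Elem k (ℓ₁' + ℓ₂')) λ e' → Game r (e ∷ ρ) (e' ∷ ρ') σ σ'
      answer-elemˡ e with part ℓ₁ ℓ₂ e
      ... | first u  = let (u' , g) = elemˡ mv₁ u in
        inl ℓ₂' u' , compose r g (down r g₂) (Split-first u u' split) res res'
      ... | second v = let (v' , g) = elemˡ mv₂ v in
        inr ℓ₁' v' , compose r (down r g₁) g (Split-second v v' split) res res'

      answer-elemʳ : ∀ e' → Σ (Elem k (ℓ₁ + ℓ₂)) λ e → Game r (e ∷ ρ) (e' ∷ ρ') σ σ'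
      answer-elemʳ e' with part ℓ₁' ℓ₂' e'
      ... | first u'  = let (u , g) = elemʳ mv₁ u' in
        inl ℓ₂ u , compose r g (down r g₂) (Split-first u u' split) res res'
      ... | second v' = let (v , g) = elemʳ mv₂ v' in
        inr ℓ₁ v , compose r (down r g₁) g (Split-second v v' split) res res'

      answer-setˡ : ∀ X → Σ (Subset k (ℓ₁' + ℓ₂')) λ X' → Game r ρ ρ' (X ∷ σ) (X' ∷ σ')
      answer-setˡ X =
        let (A' , g₁') = setˡ mv₁ (X ∘ inl ℓ₂)
            (B' , g₂') = setˡ mv₂ (X ∘ inr ℓ₁)
        in glue A' B' , compose r g₁' g₂' split (Restricts-∷ X res) (Restricts-glue A' B' res')

      answer-setʳ : ∀ X' → Σ (Subset k (ℓ₁ + ℓ₂)) λ X → Game r ρ ρ' (X ∷ σ) (X' ∷ σ')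
      answer-setʳ X' =
        let (A , g₁') = setʳ mv₁ (X' ∘ inl ℓ₂')
            (B , g₂') = setʳ mv₂ (X' ∘ inr ℓ₁')
        in glue A B , compose r g₁' g₂' split (Restricts-glue A B res) (Restricts-∷ X' res')

  -- Formulas extended by truth constants, so that empty conjunctions and
  -- disjunctions can be formed (the logic itself has no constants).
  data Formᶜ (n s : ℕ) : Set where
    ⊤ᶜ ⊥ᶜ : Formᶜ n s
    ⌞_⌟  : Form k M n s → Formᶜ n s

  Satᶜ : ∀ {n s} ℓ → Formᶜ n s → Points ℓ n → Sets ℓ s → Set
  Satᶜ ℓ ⊤ᶜ      ρ σ = ⊤
  Satᶜ ℓ ⊥ᶜ      ρ σ = ⊥
  Satᶜ ℓ ⌞ φ ⌟   ρ σ = Sat ℓ φ ρ σ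

  qrᶜ : ∀ {n s} → Formᶜ n s → ℕ
  qrᶜ ⊤ᶜ    = 0
  qrᶜ ⊥ᶜ    = 0
  qrᶜ ⌞ φ ⌟ = qr φ

  Satᶜ-resp : ∀ {ℓ n s} (φ : Formᶜ n s) {ρ : Points ℓ n} {σ₁ σ₂ : Sets ℓ s} →
              σ₁ ≐ σ₂ → Satᶜ ℓ φ ρ σ₁ → Satᶜ ℓ φ ρ σ₂
  Satᶜ-resp ⊤ᶜ    σ≐ _   = tt
  Satᶜ-resp ⊥ᶜ    σ≐ ()
  Satᶜ-resp ⌞ φ ⌟ σ≐ sat = to (Sat-resp φ (λ _ → refl) σ≐) sat

  infixr 6 _∧ᶜ_
  infixr 5 _∨ᶜ_

  _∧ᶜ_ : ∀ {n s} → Formᶜ n s → Formᶜ n s → Formᶜ n s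
  ⊤ᶜ    ∧ᶜ ψ     = ψ
  ⊥ᶜ    ∧ᶜ ψ     = ⊥ᶜ
  ⌞ φ ⌟ ∧ᶜ ⊤ᶜ    = ⌞ φ ⌟
  ⌞ φ ⌟ ∧ᶜ ⊥ᶜ    = ⊥ᶜ
  ⌞ φ ⌟ ∧ᶜ ⌞ ψ ⌟ = ⌞ and φ ψ ⌟

  _∨ᶜ_ : ∀ {n s} → Formᶜ n s → Formᶜ n s → Formᶜ n s
  ⊤ᶜ    ∨ᶜ ψ     = ⊤ᶜ
  ⊥ᶜ    ∨ᶜ ψ     = ψ
  ⌞ φ ⌟ ∨ᶜ ⊤ᶜ    = ⊤ᶜ
  ⌞ φ ⌟ ∨ᶜ ⊥ᶜ    = ⌞ φ ⌟
  ⌞ φ ⌟ ∨ᶜ ⌞ ψ ⌟ = ⌞ or φ ψ ⌟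

  -- ∃x.⊤ and ∀x.⊥ must be written out, as the grid may be empty.
  ∃¹ ∀¹ : ∀ {n s} → Formᶜ (suc n) s → Formᶜ n s
  ∃¹ ⊤ᶜ    = ⌞ ex1 (eq zero zero) ⌟
  ∃¹ ⊥ᶜ    = ⊥ᶜ
  ∃¹ ⌞ φ ⌟ = ⌞ ex1 φ ⌟
  ∀¹ ⊤ᶜ    = ⊤ᶜ
  ∀¹ ⊥ᶜ    = ⌞ all1 (neg (eq zero zero)) ⌟
  ∀¹ ⌞ φ ⌟ = ⌞ all1 φ ⌟

  ∃² ∀² : ∀ {n s} → Formᶜ n (suc s) → Formᶜ n s
  ∃² ⊤ᶜ    = ⊤ᶜ
  ∃² ⊥ᶜ    = ⊥ᶜ
  ∃² ⌞ φ ⌟ = ⌞ ex2 φ ⌟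
  ∀² ⊤ᶜ    = ⊤ᶜ
  ∀² ⊥ᶜ    = ⊥ᶜ
  ∀² ⌞ φ ⌟ = ⌞ all2 φ ⌟

  module _ {ℓ n s} {ρ : Points ℓ n} {σ : Sets ℓ s} where

    ∧ᶜ-⇔ : ∀ (φ ψ : Formᶜ n s) → Satᶜ ℓ (φ ∧ᶜ ψ) ρ σ ⇔ (Satᶜ ℓ φ ρ σ × Satᶜ ℓ ψ ρ σ)
    ∧ᶜ-⇔ ⊤ᶜ    ψ     = mk⇔ (tt ,_) proj₂
    ∧ᶜ-⇔ ⊥ᶜ    ψ     = mk⇔ (λ ()) proj₁
    ∧ᶜ-⇔ ⌞ φ ⌟ ⊤ᶜ    = mk⇔ (_, tt) proj₁
    ∧ᶜ-⇔ ⌞ φ ⌟ ⊥ᶜ    = mk⇔ (λ ()) proj₂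
    ∧ᶜ-⇔ ⌞ φ ⌟ ⌞ ψ ⌟ = mk⇔ (λ sat → sat) (λ sat → sat)

    ∨ᶜ-⇔ : ∀ (φ ψ : Formᶜ n s) → Satᶜ ℓ (φ ∨ᶜ ψ) ρ σ ⇔ (Satᶜ ℓ φ ρ σ ⊎ Satᶜ ℓ ψ ρ σ)
    ∨ᶜ-⇔ ⊤ᶜ    ψ     = mk⇔ inj₁ (λ _ → tt)
    ∨ᶜ-⇔ ⊥ᶜ    ψ     = mk⇔ inj₂ [ (λ ()) , (λ sat → sat) ]′
    ∨ᶜ-⇔ ⌞ φ ⌟ ⊤ᶜ    = mk⇔ inj₂ (λ _ → tt)
    ∨ᶜ-⇔ ⌞ φ ⌟ ⊥ᶜ    = mk⇔ inj₁ [ (λ sat → sat) , (λ ()) ]′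
    ∨ᶜ-⇔ ⌞ φ ⌟ ⌞ ψ ⌟ = mk⇔ (λ sat → sat) (λ sat → sat)

    ∃¹-⇔ : ∀ (φ : Formᶜ (suc n) s) → Satᶜ ℓ (∃¹ φ) ρ σ ⇔ Σ (Elem k ℓ) λ e → Satᶜ ℓ φ (e ∷ ρ) σ
    ∃¹-⇔ ⊤ᶜ    = mk⇔ (λ (e , _) → e , tt) (λ (e , _) → e , refl)
    ∃¹-⇔ ⊥ᶜ    = mk⇔ (λ ()) (λ ())
    ∃¹-⇔ ⌞ φ ⌟ = mk⇔ (λ sat → sat) (λ sat → sat)

    ∀¹-⇔ : ∀ (φ : Formᶜ (suc n) s) → Satᶜ ℓ (∀¹ φ) ρ σ ⇔ ((e : Elem k ℓ) → Satᶜ ℓ φ (e ∷ ρ) σ)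
    ∀¹-⇔ ⊤ᶜ    = mk⇔ (λ _ _ → tt) (λ _ → tt)
    ∀¹-⇔ ⊥ᶜ    = mk⇔ (λ ¬e e → ¬e e refl) (λ ⊥e e _ → ⊥e e)
    ∀¹-⇔ ⌞ φ ⌟ = mk⇔ (λ sat → sat) (λ sat → sat)

    ∃²-⇔ : ∀ (φ : Formᶜ n (suc s)) → Satᶜ ℓ (∃² φ) ρ σ ⇔ Σ (Subset k ℓ) λ X → Satᶜ ℓ φ ρ (X ∷ σ)
    ∃²-⇔ ⊤ᶜ    = mk⇔ (λ _ → (λ _ → false) , tt) (λ _ → tt)
    ∃²-⇔ ⊥ᶜ    = mk⇔ (λ ()) (λ ())
    ∃²-⇔ ⌞ φ ⌟ = mk⇔ (λ sat → sat) (λ sat → sat)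

    ∀²-⇔ : ∀ (φ : Formᶜ n (suc s)) → Satᶜ ℓ (∀² φ) ρ σ ⇔ ((X : Subset k ℓ) → Satᶜ ℓ φ ρ (X ∷ σ))
    ∀²-⇔ ⊤ᶜ    = mk⇔ (λ _ _ → tt) (λ _ → tt)
    ∀²-⇔ ⊥ᶜ    = mk⇔ (λ ()) (λ ⊥X → ⊥X (λ _ → false))
    ∀²-⇔ ⌞ φ ⌟ = mk⇔ (λ sat → sat) (λ sat → sat)

  qr-∧ᶜ : ∀ {n s r} (φ ψ : Formᶜ n s) → qrᶜ φ ≤ r → qrᶜ ψ ≤ r → qrᶜ (φ ∧ᶜ ψ) ≤ r
  qr-∧ᶜ ⊤ᶜ    ψ     _  ψ≤ = ψ≤
  qr-∧ᶜ ⊥ᶜ    ψ     _  _  = z≤n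
  qr-∧ᶜ ⌞ φ ⌟ ⊤ᶜ    φ≤ _  = φ≤
  qr-∧ᶜ ⌞ φ ⌟ ⊥ᶜ    _  _  = z≤n
  qr-∧ᶜ ⌞ φ ⌟ ⌞ ψ ⌟ φ≤ ψ≤ = ⊔-lub φ≤ ψ≤

  qr-∨ᶜ : ∀ {n s r} (φ ψ : Formᶜ n s) → qrᶜ φ ≤ r → qrᶜ ψ ≤ r → qrᶜ (φ ∨ᶜ ψ) ≤ r
  qr-∨ᶜ ⊤ᶜ    ψ     _  _  = z≤n
  qr-∨ᶜ ⊥ᶜ    ψ     _  ψ≤ = ψ≤
  qr-∨ᶜ ⌞ φ ⌟ ⊤ᶜ    _  _  = z≤n
  qr-∨ᶜ ⌞ φ ⌟ ⊥ᶜ    φ≤ _  = φ≤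
  qr-∨ᶜ ⌞ φ ⌟ ⌞ ψ ⌟ φ≤ ψ≤ = ⊔-lub φ≤ ψ≤

  qr-∃¹ : ∀ {n s r} (φ : Formᶜ (suc n) s) → qrᶜ φ ≤ r → qrᶜ (∃¹ φ) ≤ suc r
  qr-∃¹ ⊤ᶜ    _  = s≤s z≤n
  qr-∃¹ ⊥ᶜ    _  = z≤n
  qr-∃¹ ⌞ φ ⌟ φ≤ = s≤s φ≤

  qr-∀¹ : ∀ {n s r} (φ : Formᶜ (suc n) s) → qrᶜ φ ≤ r → qrᶜ (∀¹ φ) ≤ suc r
  qr-∀¹ ⊤ᶜ    _  = z≤n
  qr-∀¹ ⊥ᶜ    _  = s≤s z≤n
  qr-∀¹ ⌞ φ ⌟ φ≤ = s≤s φ≤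

  qr-∃² : ∀ {n s r} (φ : Formᶜ n (suc s)) → qrᶜ φ ≤ r → qrᶜ (∃² φ) ≤ suc r
  qr-∃² ⊤ᶜ    _  = z≤n
  qr-∃² ⊥ᶜ    _  = z≤n
  qr-∃² ⌞ φ ⌟ φ≤ = s≤s φ≤

  qr-∀² : ∀ {n s r} (φ : Formᶜ n (suc s)) → qrᶜ φ ≤ r → qrᶜ (∀² φ) ≤ suc r
  qr-∀² ⊤ᶜ    _  = z≤n
  qr-∀² ⊥ᶜ    _  = z≤n
  qr-∀² ⌞ φ ⌟ φ≤ = s≤s φ≤

  ⋀ ⋁ : ∀ {n s} {A : Set} → List A → (A → Formᶜ n s) → Formᶜ n s
  ⋀ []       φ = ⊤ᶜ
  ⋀ (a ∷ₗ as) φ = φ a ∧ᶜ ⋀ as φ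
  ⋁ []       φ = ⊥ᶜ
  ⋁ (a ∷ₗ as) φ = φ a ∨ᶜ ⋁ as φ

  module _ {ℓ n s} {ρ : Points ℓ n} {σ : Sets ℓ s} {A : Set} {φ : A → Formᶜ n s} where

    ⋀-⇔ : ∀ as → Satᶜ ℓ (⋀ as φ) ρ σ ⇔ (∀ {a} → a ∈ as → Satᶜ ℓ (φ a) ρ σ)
    ⋀-⇔ []        = mk⇔ (λ _ ()) (λ _ → tt)
    ⋀-⇔ (a ∷ₗ as) = ⇔-trans (∧ᶜ-⇔ (φ a) (⋀ as φ)) (mk⇔
      (λ (sat-a , sat-as) → λ { (here refl) → sat-a ; (there a∈) → to (⋀-⇔ as) sat-as a∈ })
      (λ sat → sat (here refl) , from (⋀-⇔ as) (λ b∈ → sat (there b∈))))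

    ⋁-⇔ : ∀ as → Satᶜ ℓ (⋁ as φ) ρ σ ⇔ (∃ λ a → a ∈ as × Satᶜ ℓ (φ a) ρ σ)
    ⋁-⇔ []        = mk⇔ (λ ()) (λ { (_ , () , _) })
    ⋁-⇔ (a ∷ₗ as) = ⇔-trans (∨ᶜ-⇔ (φ a) (⋁ as φ)) (mk⇔
      [ (λ sat-a → a , here refl , sat-a) , (λ sat-as → let (b , b∈ , sat-b) = to (⋁-⇔ as) sat-as in b , there b∈ , sat-b) ]′
      λ { (_ , here refl , sat-a) → inj₁ sat-a ; (b , there b∈ , sat-b) → inj₂ (from (⋁-⇔ as) (b , b∈ , sat-b)) })

  qr-⋀ : ∀ {n s r} {A : Set} as (φ : A → Formᶜ n s) → (∀ a → qrᶜ (φ a) ≤ r) → qrᶜ (⋀ as φ) ≤ r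
  qr-⋀ []        φ φ≤ = z≤n
  qr-⋀ (a ∷ₗ as) φ φ≤ = qr-∧ᶜ (φ a) (⋀ as φ) (φ≤ a) (qr-⋀ as φ φ≤)

  qr-⋁ : ∀ {n s r} {A : Set} as (φ : A → Formᶜ n s) → (∀ a → qrᶜ (φ a) ≤ r) → qrᶜ (⋁ as φ) ≤ r
  qr-⋁ []        φ φ≤ = z≤n
  qr-⋁ (a ∷ₗ as) φ φ≤ = qr-∨ᶜ (φ a) (⋁ as φ) (φ≤ a) (qr-⋁ as φ φ≤)

  elems : ∀ ℓ → List (Elem k ℓ)
  elems ℓ = cartesianProduct (allFin k) (allFin ℓ)

  ∈-elems : ∀ {ℓ} (e : Elem k ℓ) → e ∈ elems ℓ
  ∈-elems (x , y) = ∈-cartesianProduct⁺ (∈-allFin x) (∈-allFin y)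

  predicates : ∀ N → List (Fin N → Bool)
  predicates zero    = (λ ()) ∷ₗ []
  predicates (suc N) = map (true ∷_) (predicates N) ++ map (false ∷_) (predicates N)

  predicates-cover : ∀ N (g : Fin N → Bool) → Σ (Fin N → Bool) λ h → h ∈ predicates N × h ≗ g
  predicates-cover zero    g = (λ ()) , here refl , λ ()
  predicates-cover (suc N) g =
    let (h , h∈ , h≗g∘suc) = predicates-cover N (g ∘ suc)
    in g zero ∷ h , ∈-cons (g zero) h∈ , λ { zero → refl ; (suc i) → h≗g∘suc i }
    where
    ∈-cons : ∀ b {h} → h ∈ predicates N → (b ∷ h) ∈ predicates (suc N)
    ∈-cons true  h∈ = ∈-++⁺ˡ (∈-map⁺ (true ∷_) h∈)
    ∈-cons false h∈ = ∈-++⁺ʳ (map (true ∷_) (predicates N)) (∈-map⁺ (false ∷_) h∈)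

  subsets : ∀ ℓ → List (Subset k ℓ)
  subsets ℓ = map (λ h (x , y) → h (combine x y)) (predicates (k * ℓ))

  subsets-cover : ∀ {ℓ} (X : Subset k ℓ) → Σ (Subset k ℓ) λ Y → Y ∈ subsets ℓ × Y ≗ X
  subsets-cover {ℓ} X =
    let (h , h∈ , h≗X) = predicates-cover (k * ℓ) (X ∘ remQuot ℓ)
    in _ , ∈-map⁺ (λ h (x , y) → h (combine x y)) h∈ ,
       λ (x , y) → trans (h≗X (combine x y)) (cong X (Fin.remQuot-combine x y))

  ∈-pair : ∀ {C : Set} {i j} (f : Fin i → Fin j → C) (a : Fin i) (b : Fin j) →
           f a b ∈ cartesianProductWith f (allFin i) (allFin j)
  ∈-pair f a b = ∈-cartesianProductWith⁺ f (∈-allFin a) (∈-allFin b)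

  atomBlocks : ∀ n s → List (List (Atom n s))
  atomBlocks n s =
    cartesianProductWith eqᵃ  (allFin n) (allFin n) ∷ₗ
    cartesianProductWith simᵃ (allFin n) (allFin n) ∷ₗ
    cartesianProductWith Pᵃ   (allFin k) (allFin n) ∷ₗ
    cartesianProductWith memᵃ (allFin n) (allFin s) ∷ₗ
    concat (mapWith∈ M λ m∈M → cartesianProductWith (Cᵃ m∈M) (allFin _) (allFin s)) ∷ₗ []

  atoms : ∀ n s → List (Atom n s)
  atoms n s = concat (atomBlocks n s)

  ∈-block : ∀ {n s} {α : Atom n s} {block} → α ∈ block → block ∈ atomBlocks n s → α ∈ atoms n s
  ∈-block = ∈-concat⁺′

  ∈-atoms : ∀ {n s} (α : Atom n s) → α ∈ atoms n s
  ∈-atoms (eqᵃ a b)  = ∈-block (∈-pair eqᵃ a b)  (here refl)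
  ∈-atoms (simᵃ a b) = ∈-block (∈-pair simᵃ a b) (there (here refl))
  ∈-atoms (Pᵃ i a)   = ∈-block (∈-pair Pᵃ i a)   (there (there (here refl)))
  ∈-atoms (memᵃ a X) = ∈-block (∈-pair memᵃ a X) (there (there (there (here refl))))
  ∈-atoms {s = s} (Cᵃ m∈M q X) = ∈-block
    (∈-concat⁺′ (∈-pair (Cᵃ m∈M) q X)
                (mapWith∈⁺ (λ m∈M → cartesianProductWith (Cᵃ m∈M) (allFin _) (allFin s)) (_ , m∈M , refl)))
    (there (there (there (there (here refl)))))

  qr-atom : ∀ {n s r} (α : Atom n s) → qr ⌜ α ⌝ ≤ r
  qr-atom (eqᵃ _ _)   = z≤n
  qr-atom (simᵃ _ _)  = z≤n
  qr-atom (Pᵃ _ _)    = z≤n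
  qr-atom (memᵃ _ _)  = z≤n
  qr-atom (Cᵃ _ _ _)  = z≤n

  literal : ∀ {ℓ n s} (α : Atom n s) {ρ : Points ℓ n} {σ : Sets ℓ s} → Dec (Sat ℓ ⌜ α ⌝ ρ σ) → Formᶜ n s
  literal α (yes _) = ⌞ ⌜ α ⌝ ⌟
  literal α (no _)  = ⌞ neg ⌜ α ⌝ ⌟

  module _ {ℓ n s} (α : Atom n s) {ρ : Points ℓ n} {σ : Sets ℓ s} where

    qr-literal : ∀ {r} (d : Dec (Sat ℓ ⌜ α ⌝ ρ σ)) → qrᶜ (literal α d) ≤ r
    qr-literal (yes _) = qr-atom α
    qr-literal (no _)  = qr-atom α

    literal-self : (d : Dec (Sat ℓ ⌜ α ⌝ ρ σ)) → Satᶜ ℓ (literal α d) ρ σ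
    literal-self (yes α-holds) = α-holds
    literal-self (no ¬α-holds) = ¬α-holds

    literal-agree : ∀ {ℓ'} {ρ' : Points ℓ' n} {σ' : Sets ℓ' s} (d : Dec (Sat ℓ ⌜ α ⌝ ρ σ)) →
                    Satᶜ ℓ' (literal α d) ρ' σ' → Sat ℓ ⌜ α ⌝ ρ σ ⇔ Sat ℓ' ⌜ α ⌝ ρ' σ'
    literal-agree (yes α-holds) α-holds' = mk⇔ (λ _ → α-holds') (λ _ → α-holds)
    literal-agree (no ¬α-holds) ¬α-holds' = absurd⇔ ¬α-holds ¬α-holds'

  diagram : ∀ {ℓ n s} → Points ℓ n → Sets ℓ s → Formᶜ n s
  diagram {n = n} {s} ρ σ = ⋀ (atoms n s) λ α → literal α (atom? α ρ σ)

  module _ {ℓ n s} (ρ : Points ℓ n) (σ : Sets ℓ s) where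

    qr-diagram : ∀ {r} → qrᶜ (diagram ρ σ) ≤ r
    qr-diagram = qr-⋀ (atoms n s) _ λ α → qr-literal α (atom? α ρ σ)

    diagram-self : Satᶜ ℓ (diagram ρ σ) ρ σ
    diagram-self = from (⋀-⇔ (atoms n s)) λ {α} _ → literal-self α (atom? α ρ σ)

    diagram-agree : ∀ {ℓ'} {ρ' : Points ℓ' n} {σ' : Sets ℓ' s} →
                    Satᶜ ℓ' (diagram ρ σ) ρ' σ' → Agree ρ ρ' σ σ'
    diagram-agree sat α = literal-agree α (atom? α ρ σ) (to (⋀-⇔ (atoms n s)) sat (∈-atoms α))

  agree-resp : ∀ {ℓ ℓ' n s} {ρ : Points ℓ n} {ρ' : Points ℓ' n} {σ₁ σ₂ : Sets ℓ s} {σ' : Sets ℓ' s} →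
               σ₁ ≐ σ₂ → Agree ρ ρ' σ₁ σ' → Agree ρ ρ' σ₂ σ'
  agree-resp σ≐ ag α = ⇔-trans (Sat-resp ⌜ α ⌝ (λ _ → refl) λ X e → sym (σ≐ X e)) (ag α)

  game-resp : ∀ {ℓ ℓ' n s} r {ρ : Points ℓ n} {ρ' : Points ℓ' n} {σ₁ σ₂ : Sets ℓ s} {σ' : Sets ℓ' s} →
              σ₁ ≐ σ₂ → Game r ρ ρ' σ₁ σ' → Game r ρ ρ' σ₂ σ'
  game-resp zero    σ≐ ag        = agree-resp σ≐ ag
  game-resp (suc r) σ≐ (ag , mv) = agree-resp σ≐ ag , record
    { elemˡ = λ e  → let (e' , g) = elemˡ mv e  in e' , game-resp r σ≐ g
    ; elemʳ = λ e' → let (e , g)  = elemʳ mv e' in e  , game-resp r σ≐ g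
    ; setˡ  = λ X  → let (X' , g) = setˡ mv X   in X' , game-resp r (≐-∷ X σ≐) g
    ; setʳ  = λ X' → let (X , g)  = setʳ mv X'  in X  , game-resp r (≐-∷ X σ≐) g
    }


  -- One round of the Hintikka construction at the position (ρ, σ): its
  -- diagram, and the forth and back conditions for the formulas Hᵉ e (to hold
  -- after the element move e) and Hˢ X (to hold after the set move X).
  module Round {ℓ n s} (ρ : Points ℓ n) (σ : Sets ℓ s)
               (Hᵉ : Elem k ℓ → Formᶜ (suc n) s) (Hˢ : Subset k ℓ → Formᶜ n (suc s)) where

    forthᵉ backᵉ forthˢ backˢ round : Formᶜ n s
    forthᵉ = ⋀ (elems ℓ) (∃¹ ∘ Hᵉ)
    backᵉ  = ∀¹ (⋁ (elems ℓ) Hᵉ)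
    forthˢ = ⋀ (subsets ℓ) (∃² ∘ Hˢ)
    backˢ  = ∀² (⋁ (subsets ℓ) Hˢ)
    round  = diagram ρ σ ∧ᶜ forthᵉ ∧ᶜ backᵉ ∧ᶜ forthˢ ∧ᶜ backˢ

    qr-round : ∀ {r} → (∀ e → qrᶜ (Hᵉ e) ≤ r) → (∀ X → qrᶜ (Hˢ X) ≤ r) → qrᶜ round ≤ suc r
    qr-round Hᵉ≤ Hˢ≤ =
      qr-∧ᶜ (diagram ρ σ) (forthᵉ ∧ᶜ backᵉ ∧ᶜ forthˢ ∧ᶜ backˢ) (qr-diagram ρ σ) (
      qr-∧ᶜ forthᵉ (backᵉ ∧ᶜ forthˢ ∧ᶜ backˢ) (qr-⋀ (elems ℓ) (∃¹ ∘ Hᵉ) λ e → qr-∃¹ (Hᵉ e) (Hᵉ≤ e)) (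
      qr-∧ᶜ backᵉ (forthˢ ∧ᶜ backˢ) (qr-∀¹ (⋁ (elems ℓ) Hᵉ) (qr-⋁ (elems ℓ) Hᵉ Hᵉ≤)) (
      qr-∧ᶜ forthˢ backˢ (qr-⋀ (subsets ℓ) (∃² ∘ Hˢ) λ X → qr-∃² (Hˢ X) (Hˢ≤ X))
                         (qr-∀² (⋁ (subsets ℓ) Hˢ) (qr-⋁ (subsets ℓ) Hˢ Hˢ≤)))))

    record Holds {ℓ'} (ρ' : Points ℓ' n) (σ' : Sets ℓ' s) : Set where
      field
        diag       : Satᶜ ℓ' (diagram ρ σ) ρ' σ'
        forth-elem : ∀ e  → Σ (Elem k ℓ') λ e' → Satᶜ ℓ' (Hᵉ e) (e' ∷ ρ') σ'
        back-elem  : ∀ e' → Σ (Elem k ℓ) λ e → Satᶜ ℓ' (Hᵉ e) (e' ∷ ρ') σ'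
        forth-set  : ∀ {X} → X ∈ subsets ℓ → Σ (Subset k ℓ') λ X' → Satᶜ ℓ' (Hˢ X) ρ' (X' ∷ σ')
        back-set   : ∀ X' → Σ (Subset k ℓ) λ X → X ∈ subsets ℓ × Satᶜ ℓ' (Hˢ X) ρ' (X' ∷ σ')

    module _ {ℓ'} {ρ' : Points ℓ' n} {σ' : Sets ℓ' s} where

      round-⇔ : Satᶜ ℓ' round ρ' σ' ⇔
                (Satᶜ ℓ' (diagram ρ σ) ρ' σ' × Satᶜ ℓ' forthᵉ ρ' σ' × Satᶜ ℓ' backᵉ ρ' σ' ×
                 Satᶜ ℓ' forthˢ ρ' σ' × Satᶜ ℓ' backˢ ρ' σ')
      round-⇔ =
        ⇔-trans (∧ᶜ-⇔ (diagram ρ σ) (forthᵉ ∧ᶜ backᵉ ∧ᶜ forthˢ ∧ᶜ backˢ)) (⇔-refl ×-⇔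
        ⇔-trans (∧ᶜ-⇔ forthᵉ (backᵉ ∧ᶜ forthˢ ∧ᶜ backˢ)) (⇔-refl ×-⇔
        ⇔-trans (∧ᶜ-⇔ backᵉ (forthˢ ∧ᶜ backˢ)) (⇔-refl ×-⇔
        ∧ᶜ-⇔ forthˢ backˢ)))

      round-intro : Holds ρ' σ' → Satᶜ ℓ' round ρ' σ'
      round-intro h = from round-⇔
        ( diag h
        , from (⋀-⇔ (elems ℓ)) (λ {e} _ → from (∃¹-⇔ (Hᵉ e)) (forth-elem h e))
        , from (∀¹-⇔ (⋁ (elems ℓ) Hᵉ)) (λ e' →
            let (e , sat) = back-elem h e' in from (⋁-⇔ (elems ℓ)) (e , ∈-elems e , sat))
        , from (⋀-⇔ (subsets ℓ)) (λ {X} X∈ → from (∃²-⇔ (Hˢ X)) (forth-set h X∈))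
        , from (∀²-⇔ (⋁ (subsets ℓ) Hˢ)) (λ X' → from (⋁-⇔ (subsets ℓ)) (back-set h X')))
        where open Holds

      round-elim : Satᶜ ℓ' round ρ' σ' → Holds ρ' σ'
      round-elim sat = let (d , fe , be , fs , bs) = to round-⇔ sat in record
        { diag       = d
        ; forth-elem = λ e → to (∃¹-⇔ (Hᵉ e)) (to (⋀-⇔ (elems ℓ)) fe (∈-elems e))
        ; back-elem  = λ e' → let (e , _ , sat-e) = to (⋁-⇔ (elems ℓ)) (to (∀¹-⇔ (⋁ (elems ℓ) Hᵉ)) be e')
                              in e , sat-e
        ; forth-set  = λ {X} X∈ → to (∃²-⇔ (Hˢ X)) (to (⋀-⇔ (subsets ℓ)) fs X∈)
        ; back-set   = λ X' → to (⋁-⇔ (subsets ℓ)) (to (∀²-⇔ (⋁ (subsets ℓ) Hˢ)) bs X')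
        }

  hintikka : ∀ {ℓ n s} (r : ℕ) → Points ℓ n → Sets ℓ s → Formᶜ n s
  hintikka zero    ρ σ = diagram ρ σ
  hintikka (suc r) ρ σ = Round.round ρ σ (λ e → hintikka r (e ∷ ρ) σ) (λ X → hintikka r ρ (X ∷ σ))

  hintikka-qr : ∀ {ℓ n s} (r : ℕ) (ρ : Points ℓ n) (σ : Sets ℓ s) → qrᶜ (hintikka r ρ σ) ≤ r
  hintikka-qr zero    ρ σ = qr-diagram ρ σ
  hintikka-qr (suc r) ρ σ = Round.qr-round ρ σ _ _
    (λ e → hintikka-qr r (e ∷ ρ) σ) (λ X → hintikka-qr r ρ (X ∷ σ))

  -- A position satisfies its own Hintikka formula; for the back condition on
  -- sets, a set X is represented by a listed subset with the same elements.
  hintikka-self : ∀ {ℓ n s} (r : ℕ) (ρ : Points ℓ n) (σ : Sets ℓ s) → Satᶜ ℓ (hintikka r ρ σ) ρ σ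
  hintikka-self zero    ρ σ = diagram-self ρ σ
  hintikka-self (suc r) ρ σ = Round.round-intro ρ σ _ _ record
    { diag       = diagram-self ρ σ
    ; forth-elem = λ e → e , hintikka-self r (e ∷ ρ) σ
    ; back-elem  = λ e → e , hintikka-self r (e ∷ ρ) σ
    ; forth-set  = λ {X} _ → X , hintikka-self r ρ (X ∷ σ)
    ; back-set   = λ X →
        let (Y , Y∈ , Y≗X) = subsets-cover X
        in Y , Y∈ , Satᶜ-resp (hintikka r ρ (Y ∷ σ)) (≐-head Y≗X) (hintikka-self r ρ (Y ∷ σ))
    }

  hintikka-game : ∀ {ℓ ℓ' n s} (r : ℕ) (ρ : Points ℓ n) (σ : Sets ℓ s) {ρ' : Points ℓ' n} {σ' : Sets ℓ' s} →
                  Satᶜ ℓ' (hintikka r ρ σ) ρ' σ' → Game r ρ ρ' σ σ'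
  hintikka-game zero    ρ σ sat = diagram-agree ρ σ sat
  hintikka-game (suc r) ρ σ {ρ'} {σ'} sat = diagram-agree ρ σ (diag h) , record
    { elemˡ = λ e  → let (e' , sat') = forth-elem h e in e' , hintikka-game r (e ∷ ρ) σ sat'
    ; elemʳ = λ e' → let (e , sat')  = back-elem h e' in e  , hintikka-game r (e ∷ ρ) σ sat'
    ; setˡ  = λ X  →
        let (Y , Y∈ , Y≗X) = subsets-cover X
            (X' , sat')    = forth-set h Y∈
        in X' , game-resp r (≐-head Y≗X) (hintikka-game r ρ (Y ∷ σ) sat')
    ; setʳ  = λ X' → let (X , _ , sat') = back-set h X' in X , hintikka-game r ρ (X ∷ σ) sat'
    }
    where
    open Round.Holds
    h : Round.Holds ρ σ (λ e → hintikka r (e ∷ ρ) σ) (λ X → hintikka r ρ (X ∷ σ)) ρ' σ'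
    h = Round.round-elim ρ σ _ _ sat

  ρ₀ : ∀ {ℓ} → Points ℓ 0
  ρ₀ ()

  σ₀ : ∀ {ℓ} → Sets ℓ 0
  σ₀ ()

  Sat-closed : ∀ {ℓ} (φ : Sentence k M) {ρ ρ' : Points ℓ 0} {σ σ' : Sets ℓ 0} → Sat ℓ φ ρ σ ⇔ Sat ℓ φ ρ' σ'
  Sat-closed φ = Sat-resp φ (λ ()) (λ ())

  -- Completeness: ≡_r^M gives Duplicator a winning strategy in the r-round game,
  -- via the Hintikka formula of the empty position, which has rank ≤ r.
  complete : ∀ {ℓ ℓ'} r → GridEquiv k r M ℓ ℓ' → Game r (ρ₀ {ℓ}) (ρ₀ {ℓ'}) σ₀ σ₀
  complete {ℓ} {ℓ'} r equiv =
    hintikka-game r ρ₀ σ₀ (transfer (hintikka r ρ₀ σ₀) (hintikka-qr r ρ₀ σ₀) (hintikka-self r ρ₀ σ₀))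
    where
    transfer : (φ : Formᶜ 0 0) → qrᶜ φ ≤ r → Satᶜ ℓ φ ρ₀ σ₀ → Satᶜ ℓ' φ ρ₀ σ₀
    transfer ⊤ᶜ    _    _   = tt
    transfer ⌞ φ ⌟ φ≤r sat = to (Sat-closed φ) (to (equiv φ φ≤r) (to (Sat-closed φ) sat))

lemma4p2 : (k ℓ₁ ℓ₂ ℓ₁' ℓ₂' r : ℕ) (M : List ℕ) →
    NonZero k → NonZero ℓ₁ → NonZero ℓ₂ → NonZero ℓ₁' → NonZero ℓ₂' → All NonZero M →
    GridEquiv k r M ℓ₁ ℓ₁' → GridEquiv k r M ℓ₂ ℓ₂' →
    GridEquiv k r M (ℓ₁ + ℓ₂) (ℓ₁' + ℓ₂')
lemma4p2 k ℓ₁ ℓ₂ ℓ₁' ℓ₂' r M _ _ _ _ _ _ equiv₁ equiv₂ φ φ≤r =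
  ⇔-trans (Sat-closed φ) (⇔-trans (sound r glued φ φ≤r) (Sat-closed φ))
  where
  open Grids k M
  open Composition ℓ₁ ℓ₂ ℓ₁' ℓ₂'
  glued : Game r (ρ₀ {ℓ₁ + ℓ₂}) (ρ₀ {ℓ₁' + ℓ₂'}) σ₀ σ₀
  glued = compose r (complete r equiv₁) (complete r equiv₂) (λ ()) ((λ ()) , (λ ())) ((λ ()) , (λ ()))
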